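{- Let $\Sigma$ be a finite alphabet, $a\in\Sigma$, $L\subseteq\Sigma^*$ and $\gamma\in\beta(\Sigma^*\otimes\mathbb{N})$. If $\mu=\beta f_a(\gamma)$ and $L\in\beta f_r(\gamma)$, then $La\Sigma^*\in\mu$.
   Context: For a set $S$, $\beta(S)$ is the set of ultrafilters on $\mathcal{P}(S)$; for $f\colon S\to T$, $\beta f\colon\beta(S)\to\beta(T)$ is given by $L\in\beta f(\mu)$ iff $f^{ -1}(L)\in\mu$. $\Sigma^*\otimes\mathbb{N}=\{(w,i)\in\Sigma^*\times\mathbb{N}\mid i<|w|\}$. $f_a\colon\Sigma^*\otimes\mathbb{N}\to\Sigma^*$ maps $(w,i)$ to $w(a@i)$, the word $w=w_0\cdots w_{|w|-1}$ with its $i$th letter replaced by $a$; $f_r\colon\Sigma^*\otimes\mathbb{N}\to\Sigma^*$ maps $(w,i)$ to the prefix $w_0\cdots w_{i-1}$. -}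

module Defs where

open import Level using (0ℓ)
open import Data.Nat using (ℕ; zero; suc; _<_)
open import Data.Fin using (Fin)
open import Data.List using (List; []; _∷_; length; take; _++_)
open import Data.Product using (Σ; _×_; _,_; proj₁; ∃; ∃-syntax)
open import Data.Sum using (_⊎_)
open import Relation.Nullary using (¬_)
open import Relation.Unary using (Pred; _⊆_; _∩_; ∁; ∅; U; _⊢_)
open import Relation.Binary.PropositionalEquality using (_≡_)

record IsUltrafilter {S : Set} (μ : Pred S 0ℓ → Set) : Set₁ where
  field
    upward : ∀ {X Y : Pred S 0ℓ} → X ⊆ Y → μ X → μ Y
    inter  : ∀ {X Y : Pred S 0ℓ} → μ X → μ Y → μ (X ∩ Y)
    full   : μ U
    proper : ¬ μ ∅
    ultra  : ∀ (X : Pred S 0ℓ) → μ X ⊎ μ (∁ X)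

β : Set → Set₁
β S = Σ (Pred S 0ℓ → Set) IsUltrafilter

_∈β_ : {S : Set} → Pred S 0ℓ → β S → Set
L ∈β μ = proj₁ μ L

βmap : {S T : Set} → (S → T) → β S → β T
βmap {S} {T} f (μ , u) = (λ L → μ (f ⊢ L)) , record
  { upward = λ X⊆Y → IsUltrafilter.upward u X⊆Y
  ; inter  = IsUltrafilter.inter u
  ; full   = IsUltrafilter.full u
  ; proper = IsUltrafilter.proper u
  ; ultra  = λ X → IsUltrafilter.ultra u (f ⊢ X)
  }

-- Σ* ⊗ ℕ = {(w,i) | i < |w|}
Pos : Set → Set
Pos A = Σ (List A × ℕ) (λ p → Data.Nat._<_ (Data.Product.proj₂ p) (length (proj₁ p)))

replaceAt : {A : Set} → A → List A → ℕ → List A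
replaceAt a []       _       = []
replaceAt a (x ∷ w)  zero    = a ∷ w
replaceAt a (x ∷ w)  (suc i) = x ∷ replaceAt a w i

f-a : {A : Set} → A → Pos A → List A
f-a a ((w , i) , _) = replaceAt a w i

f-r : {A : Set} → Pos A → List A
f-r ((w , i) , _) = take i w

_·_·Σ* : {A : Set} → Pred (List A) 0ℓ → A → Pred (List A) 0ℓ
(L · a ·Σ*) u = ∃[ v ] ∃[ x ] (L v × u ≡ v ++ (a ∷ x))

-- A position (w, i) whose prefix w₀⋯wᵢ₋₁ lies in L is sent by f-a to
-- w₀⋯wᵢ₋₁ a wᵢ₊₁⋯, which lies in L a Σ*. So f-r⁻¹(L) ⊆ f-a⁻¹(L a Σ*), and
-- upward closure of γ carries L ∈ β f-r (γ) to L a Σ* ∈ β f-a (γ).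
module Submission where

open import Defs
open import Level using (0ℓ)
open import Data.Nat using (ℕ; zero; suc; s≤s; _<_)
open import Data.Fin using (Fin)
open import Data.List using (List; _∷_; take; drop; _++_; length)
open import Data.Product using (_,_)
open import Function.Bundles using (_↔_)
open import Relation.Unary using (Pred; _⊆′_; _⊢_)
open import Relation.Binary.PropositionalEquality using (_≡_; refl; cong)

βmap-preimage-mono : {S T U : Set} (f : S → T) (g : S → U)
  (X : Pred T 0ℓ) (Y : Pred U 0ℓ) (γ : β S) →
  f ⊢ X ⊆′ g ⊢ Y → X ∈β βmap f γ → Y ∈β βmap g γ
βmap-preimage-mono f g X Y (_ , u) f⁻¹X⊆g⁻¹Y = IsUltrafilter.upward u (f⁻¹X⊆g⁻¹Y _)

replaceAt-split : {A : Set} (a : A) (w : List A) (i : ℕ) → i < length w →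
  replaceAt a w i ≡ take i w ++ (a ∷ drop (suc i) w)
replaceAt-split a (x ∷ w) zero    _       = refl
replaceAt-split a (x ∷ w) (suc i) (s≤s p) = cong (x ∷_) (replaceAt-split a w i p)

f-r⁻¹⊆f-a⁻¹ : {A : Set} (a : A) (L : Pred (List A) 0ℓ) →
  f-r ⊢ L ⊆′ f-a a ⊢ (L · a ·Σ*)
f-r⁻¹⊆f-a⁻¹ a L ((w , i) , i<|w|) L-prefix =
  take i w , drop (suc i) w , L-prefix , replaceAt-split a w i i<|w|

lemma6p4 : (Σ' : Set) (k : ℕ) → Σ' ↔ Fin k → (a : Σ') (L : Pred (List Σ') 0ℓ)
    (γ : β (Pos Σ')) (μ : β (List Σ')) → μ ≡ βmap (f-a a) γ → L ∈β βmap f-r γ →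
    (L · a ·Σ*) ∈β μ
lemma6p4 _ _ _ a L γ _ refl =
  βmap-preimage-mono f-r (f-a a) L (L · a ·Σ*) γ (f-r⁻¹⊆f-a⁻¹ a L)
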